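{- Let $G$ be a graph, $f:E(G)\to\mathbb{N}$ an injective edge labeling, and $v$ a vertex of degree $3$. If the three edges incident on $v$ are labelled with (distinct) odd numbers, then $v$ is an AR-vertex under $f$.
   Context: All graphs are finite, simple and undirected; $\mathbb{N}=\{1,2,3,\dots\}$. Given an injective edge labeling $f:E(G)\to\mathbb{N}$, a vertex $v$ is an AR-vertex if, whenever $x_1,\dots,x_k$ are the labels of the $k$ edges incident on $v$, the $2^k$ sums $\sum_{i\in S}x_i$ over all subsets $S\subseteq\{1,\dots,k\}$ are pairwise distinct. -}

module Defs where

open import Data.Nat using (ℕ; zero; suc; _+_; _*_; _<_)
open import Data.Bool using (Bool; true; false; T)
open import Data.Fin using (Fin)
open import Data.List using (List; []; _∷_; filter; length; allFin; map)
open import Data.Vec using (Vec)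
open import Data.Fin.Subset using (Subset)
open import Data.Sum using (_⊎_)
open import Data.Product using (_×_; Σ)
open import Relation.Binary.PropositionalEquality using (_≡_)
open import Data.Bool using (T?)

record Graph (n : ℕ) : Set where
  field
    adj     : Fin n → Fin n → Bool
    symm    : ∀ u w → adj u w ≡ adj w u
    irrefl  : ∀ u → adj u u ≡ false

open Graph public

-- Edge {u,w} (unordered, adj u w) gets label lab u w; lab is symmetric on
-- edges, positive on edges, and injective on edges as unordered pairs.
-- Values of lab on non-adjacent pairs are irrelevant.
record EdgeLabeling {n : ℕ} (G : Graph n) : Set where
  field
    lab       : Fin n → Fin n → ℕ
    lab-sym   : ∀ u w → T (adj G u w) → lab u w ≡ lab w u
    lab-pos   : ∀ u w → T (adj G u w) → 0 < lab u w
    lab-inj   : ∀ u w u' w' → T (adj G u w) → T (adj G u' w') →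
                lab u w ≡ lab u' w' →
                (u ≡ u' × w ≡ w') ⊎ (u ≡ w' × w ≡ u')

open EdgeLabeling public

-- Neighbours of v (each incident edge {v,w} corresponds to exactly one w).
neighbours : ∀ {n} → Graph n → Fin n → List (Fin n)
neighbours G v = filter (λ w → T? (adj G v w)) (allFin _)

degree : ∀ {n} → Graph n → Fin n → ℕ
degree G v = length (neighbours G v)

incidentLabels : ∀ {n} {G : Graph n} → EdgeLabeling G → Fin n → List ℕ
incidentLabels {G = G} f v = map (lab f v) (neighbours G v)

subsetSum : (xs : List ℕ) → Subset (length xs) → ℕ
subsetSum []       _                = 0
subsetSum (x ∷ xs) (Vec._∷_ true  S) = x + subsetSum xs S
subsetSum (x ∷ xs) (Vec._∷_ false S) = subsetSum xs S

IsARVertex : ∀ {n} {G : Graph n} → EdgeLabeling G → Fin n → Set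
IsARVertex f v = ∀ (S S' : Subset (length (incidentLabels f v))) →
  subsetSum (incidentLabels f v) S ≡ subsetSum (incidentLabels f v) S' → S ≡ S'

Odd : ℕ → Set
Odd x = Σ ℕ (λ k → x ≡ suc (2 * k))

-- Equal subset sums of x₁, x₂, x₃ become, after cancelling the labels common to both
-- subsets, an equation l = r between the sums of two disjoint subsets. Nonempty against
-- empty is impossible since labels are positive, singleton against singleton since labels
-- are distinct, and singleton against pair since an odd number is never a sum of two odd
-- numbers.
module Submission where

open import Defs
open import Data.Nat using (ℕ; suc; _+_; _*_)
open import Data.Nat.Properties
  using (+-assoc; +-identityʳ; +-suc; +-cancelˡ-≡; *-distribˡ-+; suc-injective; even≢odd;
         +-commutativeSemigroup)
open import Algebra.Properties.CommutativeSemigroup +-commutativeSemigroup using (x∙yz≈y∙xz)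
open import Data.Bool using (true; false; T; T?)
open import Data.Fin using (Fin)
open import Data.Fin.Subset using (Subset)
open import Data.List using (List; []; _∷_; length; map; allFin)
open import Data.List.Properties using (length-map)
open import Data.List.Relation.Unary.All using (All; []; _∷_)
import Data.List.Relation.Unary.All as All
import Data.List.Relation.Unary.All.Properties as All
open import Data.List.Relation.Unary.AllPairs using ([]; _∷_)
open import Data.List.Relation.Unary.Unique.Propositional using (Unique)
import Data.List.Relation.Unary.Unique.Propositional.Properties as Unique
open import Data.Vec using ([]; _∷_)
open import Data.Product using (_,_)
open import Data.Sum using (inj₁; inj₂)
open import Data.Empty using (⊥-elim)
open import Function using (_∘_)
open import Relation.Binary.PropositionalEquality
  using (_≡_; _≢_; refl; sym; trans; cong; subst; ≢-sym; module ≡-Reasoning)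

odd+odd≢odd : ∀ {x y z} → Odd x → Odd y → Odd z → x + y ≢ z
odd+odd≢odd (i , refl) (j , refl) (k , refl) eq = even≢odd k (i + j) (begin
    2 * k                     ≡⟨ sym (suc-injective eq) ⟩
    2 * i + suc (2 * j)       ≡⟨ +-suc (2 * i) (2 * j) ⟩
    suc (2 * i + 2 * j)       ≡⟨ cong suc (sym (*-distribˡ-+ 2 i j)) ⟩
    suc (2 * (i + j))         ∎)
  where open ≡-Reasoning

SubsetSumInjective : List ℕ → Set
SubsetSumInjective xs =
  ∀ (S S' : Subset (length xs)) → subsetSum xs S ≡ subsetSum xs S' → S ≡ S'

SubsetSumsApart : ℕ → ℕ → List ℕ → Set
SubsetSumsApart l r xs =
  ∀ (S S' : Subset (length xs)) → l + subsetSum xs S ≢ r + subsetSum xs S'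

subsetSumsApart-[] : ∀ {l r} → l ≢ r → SubsetSumsApart l r []
subsetSumsApart-[] {l} {r} l≢r [] [] eq =
  l≢r (trans (sym (+-identityʳ l)) (trans eq (+-identityʳ r)))

-- A label in both subsets cancels; a label in just one moves into that side's offset.
subsetSumsApart-∷ : ∀ {l r y ys} →
  SubsetSumsApart l r ys → SubsetSumsApart (l + y) r ys → SubsetSumsApart l (r + y) ys →
  SubsetSumsApart l r (y ∷ ys)
subsetSumsApart-∷ {l} {r} {y} apart _ _ (true ∷ S) (true ∷ S') eq =
  apart S S' (+-cancelˡ-≡ y _ _ (trans (sym (x∙yz≈y∙xz l y _)) (trans eq (x∙yz≈y∙xz r y _))))
subsetSumsApart-∷ {l} {y = y} _ apartˡ _ (true ∷ S) (false ∷ S') eq =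
  apartˡ S S' (trans (+-assoc l y _) eq)
subsetSumsApart-∷ {r = r} {y} _ _ apartʳ (false ∷ S) (true ∷ S') eq =
  apartʳ S S' (trans eq (sym (+-assoc r y _)))
subsetSumsApart-∷ apart _ _ (false ∷ S) (false ∷ S') eq = apart S S' eq

subsetSumInjective-[] : SubsetSumInjective []
subsetSumInjective-[] [] [] _ = refl

subsetSumInjective-∷ : ∀ {x xs} →
  SubsetSumInjective xs → SubsetSumsApart x 0 xs → SubsetSumInjective (x ∷ xs)
subsetSumInjective-∷ {x} injective _ (true ∷ S) (true ∷ S') eq =
  cong (true ∷_) (injective S S' (+-cancelˡ-≡ x _ _ eq))
subsetSumInjective-∷ _ apart (true ∷ S) (false ∷ S') eq = ⊥-elim (apart S S' eq)
subsetSumInjective-∷ _ apart (false ∷ S) (true ∷ S') eq = ⊥-elim (apart S' S (sym eq))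
subsetSumInjective-∷ injective _ (false ∷ S) (false ∷ S') eq =
  cong (false ∷_) (injective S S' eq)

-- The inequalities λ () hold because an odd label reduces to suc of something.
oddDistinct-subsetSumInjective : ∀ {a b c} → Odd a → Odd b → Odd c →
  a ≢ b → a ≢ c → b ≢ c → SubsetSumInjective (a ∷ b ∷ c ∷ [])
oddDistinct-subsetSumInjective {b = b} {c} oa@(_ , refl) ob@(_ , refl) oc@(_ , refl) a≢b a≢c b≢c =
  subsetSumInjective-∷ injective-bc
    (subsetSumsApart-∷
      (apart-∷ (λ ()) (λ ()) a≢c)
      (apart-∷ (λ ()) (λ ()) (odd+odd≢odd oa ob oc))
      (apart-∷ a≢b (odd+odd≢odd oa oc ob) (≢-sym (odd+odd≢odd ob oc oa))))
  where
    apart-∷ : ∀ {l r y} → l ≢ r → l + y ≢ r → l ≢ r + y → SubsetSumsApart l r (y ∷ [])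
    apart-∷ l≢r ly≢r l≢ry = subsetSumsApart-∷
      (subsetSumsApart-[] l≢r) (subsetSumsApart-[] ly≢r) (subsetSumsApart-[] l≢ry)

    injective-bc : SubsetSumInjective (b ∷ c ∷ [])
    injective-bc = subsetSumInjective-∷
      (subsetSumInjective-∷ subsetSumInjective-[] (subsetSumsApart-[] (λ ())))
      (apart-∷ (λ ()) (λ ()) b≢c)

length3-subsetSumInjective : ∀ xs → length xs ≡ 3 → All Odd xs → Unique xs →
  SubsetSumInjective xs
length3-subsetSumInjective (a ∷ b ∷ c ∷ []) refl (oa ∷ ob ∷ oc ∷ [])
  ((a≢b ∷ a≢c ∷ []) ∷ (b≢c ∷ []) ∷ _) = oddDistinct-subsetSumInjective oa ob oc a≢b a≢c b≢c

map⁺-injectiveOn : ∀ {A B : Set} {P : A → Set} {f : A → B} →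
  (∀ {x y} → P x → P y → f x ≡ f y → x ≡ y) →
  ∀ {xs} → All P xs → Unique xs → Unique (map f xs)
map⁺-injectiveOn inj [] [] = []
map⁺-injectiveOn inj (px ∷ pxs) (x∉xs ∷ xs!) =
  All.map⁺ (All.zipWith (λ (py , x≢y) → x≢y ∘ inj px py) (pxs , x∉xs))
    ∷ map⁺-injectiveOn inj pxs xs!

module _ {n} {G : Graph n} (f : EdgeLabeling G) (v : Fin n) where

  lab-injectiveAt : ∀ {w w'} → T (adj G v w) → T (adj G v w') →
    lab f v w ≡ lab f v w' → w ≡ w'
  lab-injectiveAt vw vw' eq with lab-inj f v _ v _ vw vw' eq
  ... | inj₁ (_ , w≡w') = w≡w'
  ... | inj₂ (_ , w≡v) = ⊥-elim (subst T (irrefl G v) (subst (T ∘ adj G v) w≡v vw))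

  incidentLabels-unique : Unique (incidentLabels f v)
  incidentLabels-unique = map⁺-injectiveOn lab-injectiveAt
    (All.all-filter (T? ∘ adj G v) (allFin n))
    (Unique.filter⁺ (T? ∘ adj G v) (Unique.allFin⁺ n))

lemma2 : ∀ {n} (G : Graph n) (f : EdgeLabeling G) (v : Fin n) →
    degree G v ≡ 3 →
    All Odd (incidentLabels f v) →
    IsARVertex f v
lemma2 G f v deg≡3 odd =
  length3-subsetSumInjective (incidentLabels f v)
    (trans (length-map (lab f v) (neighbours G v)) deg≡3)
    odd
    (incidentLabels-unique f v)
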